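{- For each positive integer $k$, $s_k\ge 2s_{r(k)}$.
   Context: Sequence $s_n$: let $A_1=(5)$ and for $k\ge2$ let $A_k$ be the concatenation $A_{k-1},A_{k-1},(1)$; $A$ is the limiting infinite list; $a_0=0$, $a_n$ is the $n$th entry of $A$ for $n\ge1$, and $s_n=a_0+\cdots+a_n$ (so $s_0=0$). For $i\ge1$ let $M_i=2^i-1$. $M$-expansion of a positive integer $n$: let $\ell=\max\{i:n\ge M_i\}$ and write $n=M_\ell+r$ with $0\le r\le M_\ell$; if $r=0$ stop with $n=M_\ell$; if $r=M_\ell$ stop with $n=2M_\ell$; otherwise continue with $r$. This gives $n=\varepsilon_1M_1+\cdots+\varepsilon_\ell M_\ell$ with $\varepsilon_i\in\{0,1,2\}$. The reduction of $k$ with this expansion is $r(k)=\varepsilon_2M_1+\varepsilon_3M_2+\cdots+\varepsilon_\ell M_{\ell-1}$ (so $r(k)=0$ when $\ell=1$). -}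

module Defs where

open import Data.Nat using (ℕ; zero; suc; _+_; _*_; _∸_; _^_; _≤?_; _≟_)
open import Data.List using (List; []; _∷_; _++_; [_]; map; sum; filter; length)
open import Data.Bool using (Bool; true; false; if_then_else_)
open import Relation.Nullary.Decidable using (does)

A : ℕ → List ℕ
A zero = []            -- unused
A (suc zero) = 5 ∷ []
A (suc (suc k)) = A (suc k) ++ A (suc k) ++ [ 1 ]

index : List ℕ → ℕ → ℕ
index [] _ = 0
index (x ∷ xs) zero = x
index (x ∷ xs) (suc i) = index xs i

-- a_0 = 0; a_n = n-th entry (1-based) of the limiting list A.
-- A_n (length 2^n - 1 ≥ n) is a prefix of the limit and contains position n.
a : ℕ → ℕ
a zero = 0
a (suc m) = index (A (suc m)) m

s : ℕ → ℕ
s zero = a zero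
s (suc n) = s n + a (suc n)

M : ℕ → ℕ
M i = 2 ^ i ∸ 1

searchLevel : ℕ → ℕ → ℕ
searchLevel zero n = 0
searchLevel (suc j) n = if does (M (suc j) ≤? n) then suc j else searchLevel j n

-- ℓ(n) = max { i ≥ 1 : n ≥ M_i }  (for n ≥ 1; any such i satisfies i ≤ n)
level : ℕ → ℕ
level n = searchLevel n n

-- The greedy M-expansion, recorded as the list of indices i used
-- (with multiplicity); fuel bounds the number of steps.
expIdx : ℕ → ℕ → List ℕ
expIdx zero n = []
expIdx (suc f) zero = []
expIdx (suc f) (suc m) =
  let n = suc m
      l = level n
      r = n ∸ M l
  in if does (r ≟ 0) then l ∷ []
     else if does (r ≟ M l) then l ∷ l ∷ []
     else l ∷ expIdx f r

-- n = ε_1 M_1 + ... + ε_ℓ M_ℓ : ε_i = multiplicity of i in the expansion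
ε : ℕ → ℕ → ℕ
ε n i = length (filter (λ j → j ≟ i) (expIdx n n))

sumFrom2 : ℕ → (ℕ → ℕ) → ℕ
sumFrom2 zero f = 0
sumFrom2 (suc zero) f = 0
sumFrom2 (suc (suc u)) f = sumFrom2 (suc u) f + f (suc (suc u))

red : ℕ → ℕ
red k = sumFrom2 (level k) (λ i → ε k i * M (i ∸ 1))

-- Since A_(t+1) = A_t A_t 1, the partial sums are additive across the midpoint:
-- s (M_t + x) = s M_t + s x for x ≤ M_t, and hence 2 s M_t ≤ s M_(t+1).
-- The greedy expansion writes n = M_l + r with r ≤ M_l, and the reduction of n is
-- M_(l-1) plus the reduction R of r.  By induction on n one proves 2 R ≤ r and
-- 2 s R ≤ s r simultaneously: the first bound gives R ≤ M_(l-1), so s splits at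
-- M_(l-1) + R, and the two halving inequalities add up.

module Submission where

open import Defs
open import Data.Nat
open import Data.Nat.Properties
open import Data.Bool using (if_then_else_)
open import Data.List using (List; []; _∷_; _++_; [_]; map; length; filter)
open import Data.Nat.ListAction using (sum)
open import Algebra.Properties.CommutativeSemigroup +-commutativeSemigroup using (interchange)
import Data.List.Properties as List
open import Data.List.Relation.Unary.All as All using (All; []; _∷_)
open import Data.Product using (_×_; _,_)
open import Relation.Binary.PropositionalEquality hiding ([_])
open import Relation.Nullary using (Dec; yes; no; does; ¬_; contradiction)
open import Relation.Nullary.Decidable using (dec-true; dec-false)

if-yes : ∀ {P : Set} {A : Set} (P? : Dec P) {x y : A} → P → (if does P? then x else y) ≡ x
if-yes P? {x} {y} p = cong (if_then x else y) (dec-true P? p)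

if-no : ∀ {P : Set} {A : Set} (P? : Dec P) {x y : A} → ¬ P → (if does P? then x else y) ≡ y
if-no P? {x} {y} ¬p = cong (if_then x else y) (dec-false P? ¬p)

M-suc : ∀ i → M (suc i) ≡ suc (2 * M i)
M-suc i = shift (2 ^ i) (m^n>0 2 i)
  where
  shift : ∀ p → 1 ≤ p → 2 * p ∸ 1 ≡ suc (2 * (p ∸ 1))
  shift (suc q) _ = +-suc q (q + 0)

M-mono-≤ : ∀ {i j} → i ≤ j → M i ≤ M j
M-mono-≤ i≤j = ∸-monoˡ-≤ 1 (^-monoʳ-≤ 2 i≤j)

M-cancel-< : ∀ {i j} → M i < M j → i < j
M-cancel-< {i} {j} Mi<Mj with i <? j
... | yes i<j = i<j
... | no i≮j = contradiction (M-mono-≤ (≮⇒≥ i≮j)) (<⇒≱ Mi<Mj)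

n<M[1+n] : ∀ n → n < M (suc n)
n<M[1+n] zero = s≤s z≤n
n<M[1+n] (suc n) rewrite M-suc (suc n) = s≤s (≤-trans (n<M[1+n] n) (m≤m+n _ _))

M<M[1+] : ∀ l → M l < M (suc l)
M<M[1+] l rewrite M-suc l = s≤s (m≤m+n (M l) _)

length-A : ∀ j → length (A j) ≡ M j
length-A zero = refl
length-A (suc zero) = refl
length-A (suc (suc j)) = begin
  length (B ++ B ++ [ 1 ])         ≡⟨ List.length-++ B ⟩
  length B + length (B ++ [ 1 ])   ≡⟨ cong (length B +_) (List.length-++ B) ⟩
  length B + (length B + 1)        ≡⟨ cong (λ m → m + (m + 1)) (length-A (suc j)) ⟩
  m + (m + 1)                      ≡⟨ cong (m +_) (+-comm m 1) ⟩
  m + suc m                        ≡⟨ +-suc m m ⟩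
  suc (m + m)                      ≡⟨ cong (λ k → suc (m + k)) (sym (+-identityʳ m)) ⟩
  suc (2 * m)                      ≡⟨ sym (M-suc (suc j)) ⟩
  M (suc (suc j))                  ∎
  where
  open ≡-Reasoning
  B = A (suc j)
  m = M (suc j)

index-++ˡ : ∀ (xs ys : List ℕ) {i} → i < length xs → index (xs ++ ys) i ≡ index xs i
index-++ˡ (x ∷ xs) ys {zero} _ = refl
index-++ˡ (x ∷ xs) ys {suc i} (s≤s i<n) = index-++ˡ xs ys i<n

index-++ʳ : ∀ (xs ys : List ℕ) i → index (xs ++ ys) (length xs + i) ≡ index ys i
index-++ʳ [] ys i = refl
index-++ʳ (x ∷ xs) ys i = index-++ʳ xs ys i

index-A-suc : ∀ j {i} → i < M j → index (A (suc j)) i ≡ index (A j) i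
index-A-suc (suc j) {i} i<M = index-++ˡ (A (suc j)) _ (subst (i <_) (sym (length-A (suc j))) i<M)

index-A-+ : ∀ d j {i} → i < M j → index (A (d + j)) i ≡ index (A j) i
index-A-+ zero j i<M = refl
index-A-+ (suc d) j i<M =
  trans (index-A-suc (d + j) (<-≤-trans i<M (M-mono-≤ (m≤n+m j d)))) (index-A-+ d j i<M)

-- a (suc m) is read off A (suc m), but every A j is a prefix of the limit, so any A j long enough will do.
a≡index-A : ∀ j {m} → m < M j → a (suc m) ≡ index (A j) m
a≡index-A j {m} m<M = begin
  index (A (suc m)) m          ≡⟨ sym (index-A-+ j (suc m) (n<M[1+n] m)) ⟩
  index (A (j + suc m)) m      ≡⟨ cong (λ k → index (A k) m) (+-comm j (suc m)) ⟩
  index (A (suc m + j)) m      ≡⟨ index-A-+ (suc m) j m<M ⟩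
  index (A j) m                ∎
  where open ≡-Reasoning

a-shift : ∀ t {x} → x < M t → a (suc (M t + x)) ≡ a (suc x)
a-shift (suc t) {x} x<M = begin
  a (suc (M (suc t) + x))                 ≡⟨ a≡index-A (suc (suc t)) M+x<M ⟩
  index (B ++ B ++ [ 1 ]) (M (suc t) + x) ≡⟨ cong (λ k → index (B ++ B ++ [ 1 ]) (k + x)) (sym (length-A (suc t))) ⟩
  index (B ++ B ++ [ 1 ]) (length B + x)  ≡⟨ index-++ʳ B _ x ⟩
  index (B ++ [ 1 ]) x                    ≡⟨ index-++ˡ B [ 1 ] (subst (x <_) (sym (length-A (suc t))) x<M) ⟩
  index B x                               ≡⟨ sym (a≡index-A (suc t) x<M) ⟩
  a (suc x)                               ∎
  where
  open ≡-Reasoning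
  B = A (suc t)
  M+x<M : M (suc t) + x < M (suc (suc t))
  M+x<M rewrite M-suc (suc t) = s≤s (+-monoʳ-≤ (M (suc t)) (≤-trans (<⇒≤ x<M) (m≤m+n _ 0)))

s-split : ∀ t {x} → x ≤ M t → s (M t + x) ≡ s (M t) + s x
s-split t {zero} _ = trans (cong s (+-identityʳ (M t))) (sym (+-identityʳ (s (M t))))
s-split t {suc x} x<M = begin
  s (M t + suc x)                   ≡⟨ cong s (+-suc (M t) x) ⟩
  s (M t + x) + a (suc (M t + x))   ≡⟨ cong₂ _+_ (s-split t (<⇒≤ x<M)) (a-shift t x<M) ⟩
  s (M t) + s x + a (suc x)         ≡⟨ +-assoc (s (M t)) (s x) _ ⟩
  s (M t) + s (suc x)               ∎
  where open ≡-Reasoning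

s-M-suc : ∀ t → 2 * s (M t) ≤ s (M (suc t))
s-M-suc t = begin
  2 * s (M t)              ≡⟨ cong (s (M t) +_) (+-identityʳ (s (M t))) ⟩
  s (M t) + s (M t)        ≡⟨ sym (s-split t ≤-refl) ⟩
  s (M t + M t)            ≡⟨ cong (λ k → s (M t + k)) (sym (+-identityʳ (M t))) ⟩
  s (2 * M t)              ≤⟨ m≤m+n _ _ ⟩
  s (suc (2 * M t))        ≡⟨ cong s (sym (M-suc t)) ⟩
  s (M (suc t))            ∎
  where open ≤-Reasoning

half-≤ : ∀ {m n} → 2 * m ≤ suc (2 * n) → m ≤ n
half-≤ {m} {n} 2m≤1+2n = ≤-pred (*-cancelˡ-< 2 m (suc n) (≤-trans (s≤s 2m≤1+2n) (≤-reflexive (sym (*-suc 2 n)))))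

AtMostHalf : ℕ → ℕ → Set
AtMostHalf R n = 2 * R ≤ n × 2 * s R ≤ s n

atMostHalf-step : ∀ t {r R} → r ≤ M (suc t) → AtMostHalf R r → AtMostHalf (M t + R) (M (suc t) + r)
atMostHalf-step t {r} {R} r≤M (2R≤r , 2sR≤sr) = 2[M+R]≤M+r , 2s[M+R]≤s[M+r]
  where
  open ≤-Reasoning
  2M≤M : 2 * M t ≤ M (suc t)
  2M≤M = ≤-trans (n≤1+n _) (≤-reflexive (sym (M-suc t)))
  R≤M : R ≤ M t
  R≤M = half-≤ (≤-trans 2R≤r (≤-trans r≤M (≤-reflexive (M-suc t))))
  2[M+R]≤M+r : 2 * (M t + R) ≤ M (suc t) + r
  2[M+R]≤M+r = begin
    2 * (M t + R)       ≡⟨ *-distribˡ-+ 2 (M t) R ⟩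
    2 * M t + 2 * R     ≤⟨ +-mono-≤ 2M≤M 2R≤r ⟩
    M (suc t) + r       ∎
  2s[M+R]≤s[M+r] : 2 * s (M t + R) ≤ s (M (suc t) + r)
  2s[M+R]≤s[M+r] = begin
    2 * s (M t + R)             ≡⟨ cong (2 *_) (s-split t R≤M) ⟩
    2 * (s (M t) + s R)         ≡⟨ *-distribˡ-+ 2 (s (M t)) (s R) ⟩
    2 * s (M t) + 2 * s R       ≤⟨ +-mono-≤ (s-M-suc t) 2sR≤sr ⟩
    s (M (suc t)) + s r         ≡⟨ sym (s-split (suc t) r≤M) ⟩
    s (M (suc t) + r)           ∎

searchLevel-yes : ∀ j n → M (suc j) ≤ n → searchLevel (suc j) n ≡ suc j
searchLevel-yes j n = if-yes (M (suc j) ≤? n)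

searchLevel-no : ∀ j n → ¬ M (suc j) ≤ n → searchLevel (suc j) n ≡ searchLevel j n
searchLevel-no j n = if-no (M (suc j) ≤? n)

M-searchLevel≤ : ∀ j n → M (searchLevel j n) ≤ n
M-searchLevel≤ zero n = z≤n
M-searchLevel≤ (suc j) n with M (suc j) ≤? n
... | yes Mj≤n rewrite searchLevel-yes j n Mj≤n = Mj≤n
... | no Mj≰n rewrite searchLevel-no j n Mj≰n = M-searchLevel≤ j n

searchLevel-pos : ∀ j n → 1 ≤ n → 1 ≤ searchLevel (suc j) n
searchLevel-pos j n 1≤n with M (suc j) ≤? n
... | yes Mj≤n rewrite searchLevel-yes j n Mj≤n = s≤s z≤n
searchLevel-pos zero n 1≤n | no M1≰n = contradiction 1≤n M1≰n
searchLevel-pos (suc j) n 1≤n | no Mj≰n rewrite searchLevel-no (suc j) n Mj≰n = searchLevel-pos j n 1≤n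

<M-suc-searchLevel : ∀ j n → n < M (suc j) → n < M (suc (searchLevel j n))
<M-suc-searchLevel zero n n<M = n<M
<M-suc-searchLevel (suc j) n n<M with M (suc j) ≤? n
... | yes Mj≤n rewrite searchLevel-yes j n Mj≤n = n<M
... | no Mj≰n rewrite searchLevel-no j n Mj≰n = <M-suc-searchLevel j n (≰⇒> Mj≰n)

M-level≤ : ∀ n → M (level n) ≤ n
M-level≤ n = M-searchLevel≤ n n

level-pos : ∀ m → 1 ≤ level (suc m)
level-pos m = searchLevel-pos m (suc m) (s≤s z≤n)

<M-suc-level : ∀ n → n < M (suc (level n))
<M-suc-level n = <M-suc-searchLevel n n (n<M[1+n] n)

level-≤ : ∀ {n l} → n < M (suc l) → level n ≤ l
level-≤ {n} n<M = ≤-pred (M-cancel-< (≤-<-trans (M-level≤ n) n<M))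

∸M-level≤M-level : ∀ n → n ∸ M (level n) ≤ M (level n)
∸M-level≤M-level n = m≤n+o⇒m∸n≤o n (M l) (begin
  n              ≤⟨ ≤-pred (subst (n <_) (M-suc l) (<M-suc-level n)) ⟩
  2 * M l        ≡⟨ cong (M l +_) (+-identityʳ (M l)) ⟩
  M l + M l      ∎)
  where
  open ≤-Reasoning
  l = level n

reduction : List ℕ → ℕ
reduction L = sum (map (λ i → M (i ∸ 1)) L)

Reduces : ℕ → ℕ → List ℕ → Set
Reduces l n L = All (_≤ l) L × AtMostHalf (reduction L) n

reduces-[] : ∀ {l} → Reduces l 0 []
reduces-[] = [] , z≤n , z≤n

reduces-∷ : ∀ {t r n E} → M (suc t) + r ≡ n → r ≤ M (suc t) → Reduces (suc t) r E → Reduces (suc t) n (suc t ∷ E)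
reduces-∷ {t} refl r≤M (bounded , half) = ≤-refl ∷ bounded , atMostHalf-step t r≤M half

reduces-weaken : ∀ {l l' n L} → l ≤ l' → Reduces l n L → Reduces l' n L
reduces-weaken l≤l' (bounded , half) = All.map (λ i≤l → ≤-trans i≤l l≤l') bounded , half

greedy-reduces : ∀ {l f n} r → 1 ≤ l → M l + r ≡ n → r ≤ M l → Reduces l r (expIdx f r) →
  Reduces l n (if does (r ≟ 0) then l ∷ [] else if does (r ≟ M l) then l ∷ l ∷ [] else l ∷ expIdx f r)
greedy-reduces {suc t} {f} {n} r (s≤s z≤n) Ml+r≡n r≤M tail with r ≟ 0
... | yes refl = reduces-∷ Ml+r≡n z≤n reduces-[]
... | no r≢0 with r ≟ M (suc t)
...   | yes refl = subst (Reduces (suc t) n) (sym (trans (if-no (r ≟ 0) r≢0) (if-yes (r ≟ r) refl)))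
  (reduces-∷ Ml+r≡n ≤-refl (reduces-∷ (+-identityʳ _) z≤n reduces-[]))
...   | no r≢M = subst (Reduces (suc t) n) (sym (trans (if-no (r ≟ 0) r≢0) (if-no (r ≟ M (suc t)) r≢M)))
  (reduces-∷ Ml+r≡n r≤M tail)

expIdx-reduces : ∀ f n → n ≤ f → Reduces (level n) n (expIdx f n)
expIdx-reduces zero zero _ = reduces-[]
expIdx-reduces (suc f) zero _ = reduces-[]
expIdx-reduces (suc f) (suc m) (s≤s m≤f) =
  greedy-reduces {f = f} r (level-pos m) (m+[n∸m]≡n (M-level≤ n)) r≤M
    (reduces-weaken (level-≤ (≤-<-trans r≤M (M<M[1+] l))) (expIdx-reduces f r r≤f))
  where
  n = suc m
  l = level n
  r = n ∸ M l
  r≤M : r ≤ M l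
  r≤M = ∸M-level≤M-level n
  r≤f : r ≤ f
  r≤f = ≤-trans (∸-monoʳ-≤ n (M-mono-≤ (level-pos m))) m≤f

occurrences : ℕ → List ℕ → ℕ
occurrences i L = length (filter (_≟ i) L)

sumFrom2-cong : ∀ u {f g : ℕ → ℕ} → (∀ i → f i ≡ g i) → sumFrom2 u f ≡ sumFrom2 u g
sumFrom2-cong zero f≗g = refl
sumFrom2-cong (suc zero) f≗g = refl
sumFrom2-cong (suc (suc u)) f≗g = cong₂ _+_ (sumFrom2-cong (suc u) f≗g) (f≗g (suc (suc u)))

sumFrom2-+ : ∀ u (f g : ℕ → ℕ) → sumFrom2 u (λ i → f i + g i) ≡ sumFrom2 u f + sumFrom2 u g
sumFrom2-+ zero f g = refl
sumFrom2-+ (suc zero) f g = refl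
sumFrom2-+ (suc (suc u)) f g = trans (cong (_+ (f (suc (suc u)) + g (suc (suc u)))) (sumFrom2-+ (suc u) f g))
  (interchange (sumFrom2 (suc u) f) (sumFrom2 (suc u) g) (f (suc (suc u))) (g (suc (suc u))))

sumFrom2-0 : ∀ u → sumFrom2 u (λ _ → 0) ≡ 0
sumFrom2-0 zero = refl
sumFrom2-0 (suc zero) = refl
sumFrom2-0 (suc (suc u)) = trans (+-identityʳ _) (sumFrom2-0 (suc u))

module _ (h : ℕ → ℕ) (h0≡0 : h 0 ≡ 0) (h1≡0 : h 1 ≡ 0) where

  indicator : ℕ → ℕ → ℕ
  indicator x i = if does (x ≟ i) then h i else 0

  sumFrom2-indicator-< : ∀ x u → u < x → sumFrom2 u (indicator x) ≡ 0
  sumFrom2-indicator-< x zero _ = refl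
  sumFrom2-indicator-< x (suc zero) _ = refl
  sumFrom2-indicator-< x (suc (suc u)) u<x = cong₂ _+_
    (sumFrom2-indicator-< x (suc u) (<-trans (n<1+n _) u<x)) (if-no (x ≟ suc (suc u)) (≢-sym (<⇒≢ u<x)))

  sumFrom2-indicator : ∀ u {x} → x ≤ u → sumFrom2 u (indicator x) ≡ h x
  sumFrom2-indicator zero z≤n = sym h0≡0
  sumFrom2-indicator (suc zero) z≤n = sym h0≡0
  sumFrom2-indicator (suc zero) (s≤s z≤n) = sym h1≡0
  -- The recursive call is passed to by-cases so that termination stays structural.
  sumFrom2-indicator (suc (suc u)) {x} x≤u = by-cases (x ≟ suc (suc u)) (sumFrom2-indicator (suc u))
    where
    by-cases : Dec (x ≡ suc (suc u)) → (x ≤ suc u → sumFrom2 (suc u) (indicator x) ≡ h x) →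
               sumFrom2 (suc (suc u)) (indicator x) ≡ h x
    by-cases (yes x≡u) _ = begin
      sumFrom2 (suc u) (indicator x) + indicator x (suc (suc u))
        ≡⟨ cong₂ _+_ (sumFrom2-indicator-< x (suc u) (≤-reflexive (sym x≡u))) (if-yes (x ≟ suc (suc u)) x≡u) ⟩
      h (suc (suc u))
        ≡⟨ cong h (sym x≡u) ⟩
      h x ∎
      where open ≡-Reasoning
    by-cases (no x≢u) ih = trans
      (cong₂ _+_ (ih (≤-pred (≤∧≢⇒< x≤u x≢u))) (if-no (x ≟ suc (suc u)) x≢u))
      (+-identityʳ (h x))

  occurrences-∷ : ∀ x L i → occurrences i (x ∷ L) * h i ≡ indicator x i + occurrences i L * h i
  occurrences-∷ x L i with x ≟ i
  ... | yes x≡i = trans (cong (λ L' → length L' * h i) (List.filter-accept (_≟ i) x≡i))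
    (cong (_+ occurrences i L * h i) (sym (if-yes (x ≟ i) x≡i)))
  ... | no x≢i = trans (cong (λ L' → length L' * h i) (List.filter-reject (_≟ i) x≢i))
    (cong (_+ occurrences i L * h i) (sym (if-no (x ≟ i) x≢i)))

  sumFrom2-occurrences : ∀ u L → All (_≤ u) L → sumFrom2 u (λ i → occurrences i L * h i) ≡ sum (map h L)
  sumFrom2-occurrences u [] [] = sumFrom2-0 u
  sumFrom2-occurrences u (x ∷ L) (x≤u ∷ L≤u) = begin
    sumFrom2 u (λ i → occurrences i (x ∷ L) * h i)                     ≡⟨ sumFrom2-cong u (occurrences-∷ x L) ⟩
    sumFrom2 u (λ i → indicator x i + occurrences i L * h i)           ≡⟨ sumFrom2-+ u (indicator x) _ ⟩
    sumFrom2 u (indicator x) + sumFrom2 u (λ i → occurrences i L * h i) ≡⟨ cong₂ _+_ (sumFrom2-indicator u x≤u) (sumFrom2-occurrences u L L≤u) ⟩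
    h x + sum (map h L)                                                ∎
    where open ≡-Reasoning

red≡reduction : ∀ n → All (_≤ level n) (expIdx n n) → red n ≡ reduction (expIdx n n)
red≡reduction n = sumFrom2-occurrences (λ i → M (i ∸ 1)) refl refl (level n) (expIdx n n)

corollary2p4 : (k : ℕ) → 2 * s (red (suc k)) ≤ s (suc k)
corollary2p4 k with expIdx-reduces (suc k) (suc k) ≤-refl
... | bounded , _ , 2sR≤sn = subst (λ R → 2 * s R ≤ s (suc k)) (sym (red≡reduction (suc k) bounded)) 2sR≤sn
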